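{- The map $$ \Gamma(N, MN)\backslash\mathrm{SL}_2(\mathbb{Z})\to\mathcal{S}_{2,1}(C_N\times C_{MN}),\quad \begin{pmatrix} a&b\\c&d \end{pmatrix}\mapsto \begin{pmatrix} a\bmod N&b\bmod N\\c\bmod{MN}&d\bmod{MN} \end{pmatrix} $$ is a well-defined bijection between finite sets.
   Context: Let $N\geq 2$ and $M\geq 1$ be integers, and $C_k$ denote the cyclic group of order $k$. Define the congruence subgroup $$ \Gamma(N, MN)=\left\{\begin{pmatrix}a&b\\c&d\end{pmatrix}\in\mathrm{SL}_2(\mathbb{Z})\,:\, a\equiv 1\ (\mathrm{mod}\ N),\ b\equiv 0\ (\mathrm{mod}\ N),\ c\equiv 0\ (\mathrm{mod}\ MN),\ d\equiv 1\ (\mathrm{mod}\ MN)\right\}. $$ Identify the character group $(C_N\times C_{MN})^\vee$ with $\mathbb{Z}/N\times\mathbb{Z}/MN$. The set $\mathcal{S}_{2,1}(C_N\times C_{MN})$ is the finite set of matrices $\begin{pmatrix} a_1&a_2\\ b_1&b_2\end{pmatrix}$ such that $a_i\in\mathbb{Z}/N$, $b_i\in\mathbb{Z}/MN$, $\mathbb{Z}(a_1,b_1)+\mathbb{Z}(a_2,b_2)=(C_N\times C_{MN})^\vee$, and $a_1b_2-a_2b_1\equiv 1\pmod N$. -}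

module Defs where

open import Data.Nat as ℕ using (ℕ; NonZero)
open import Data.Nat.Properties using (m*n≢0)
open import Data.Integer using (ℤ; +_; _-_; _*_; _+_; _%ℕ_)
open import Data.Integer.DivMod using (n%ℕd<d)
open import Data.Integer.Divisibility using (_∣_)
open import Data.Fin using (Fin; toℕ; fromℕ<)
open import Data.Product using (Σ; _×_; _,_; proj₁)
open import Relation.Binary.PropositionalEquality using (_≡_)

_≋_[mod_] : ℤ → ℤ → ℕ → Set
x ≋ y [mod n ] = (+ n) ∣ (x - y)

⟦_⟧ : {n : ℕ} → Fin n → ℤ
⟦ i ⟧ = + toℕ i

record Mat : Set where
  constructor mat
  field
    a b c d : ℤ

_·_ : Mat → Mat → Mat
mat a b c d · mat a' b' c' d' =
  mat (a * a' + b * c') (a * b' + b * d') (c * a' + d * c') (c * b' + d * d')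

det : Mat → ℤ
det (mat a b c d) = a * d - b * c

SL2Z : Set
SL2Z = Σ Mat (λ g → det g ≡ + 1)

module _ (N M : ℕ) .{{_ : NonZero N}} .{{_ : NonZero M}} where

  MN : ℕ
  MN = M ℕ.* N

  instance
    nzMN : NonZero MN
    nzMN = m*n≢0 M N

  InΓ : SL2Z → Set
  InΓ (mat a b c d , _) =
    (a ≋ + 1 [mod N ]) × (b ≋ + 0 [mod N ]) × (c ≋ + 0 [mod MN ]) × (d ≋ + 1 [mod MN ])

  SameCoset : SL2Z → SL2Z → Set
  SameCoset (g , _) (g' , _) = Σ SL2Z (λ γ → InΓ γ × (proj₁ γ · g ≡ g'))

  red : (n : ℕ) .{{_ : NonZero n}} → ℤ → Fin n
  red n x = fromℕ< (n%ℕd<d x n)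

  -- the underlying data of an element of S_{2,1}: (a1 a2 ; b1 b2)
  record Entries : Set where
    constructor entries
    field
      a₁ a₂ : Fin N
      b₁ b₂ : Fin MN

  InS : Entries → Set
  InS (entries a₁ a₂ b₁ b₂) =
    ((x : Fin N) (y : Fin MN) →
       Σ ℤ (λ m → Σ ℤ (λ n →
         ((m * ⟦ a₁ ⟧ + n * ⟦ a₂ ⟧) ≋ ⟦ x ⟧ [mod N ]) ×
         ((m * ⟦ b₁ ⟧ + n * ⟦ b₂ ⟧) ≋ ⟦ y ⟧ [mod MN ]))))
    × ((⟦ a₁ ⟧ * ⟦ b₂ ⟧ - ⟦ a₂ ⟧ * ⟦ b₁ ⟧) ≋ + 1 [mod N ])

  φ : SL2Z → Entries
  φ (mat a b c d , _) = entries (red N a) (red N b) (red MN c) (red MN d)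

  IsWellDefinedBijection : Set
  IsWellDefinedBijection =
      ((g : SL2Z) → InS (φ g))
    × ((g g' : SL2Z) → SameCoset g g' → φ g ≡ φ g')
    × ((g g' : SL2Z) → φ g ≡ φ g' → SameCoset g g')
    × ((s : Entries) → InS s → Σ SL2Z (λ g → φ g ≡ s))

-- Write g ~ h when the top rows of g and h agree modulo N and the bottom rows
-- modulo MN. Then φ g = φ h iff g ~ h, Γ(N, MN) is the ~-class of the identity,
-- and ~ is preserved by right multiplication, since row operations act on each
-- row separately. Hence γ ∈ Γ gives γg ~ g, and g' ~ g gives g'g⁻¹ ~ gg⁻¹ = 1:
-- φ is well defined and injective on cosets. By Cramer's rule the columns of g
-- generate ℤ², and det g = 1 survives reduction, so φ g lies in S.
-- For surjectivity, generating (0, 1) gives m b₁ + k b₂ − 1 = K·MN. Write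
-- (b₁, b₂) = u (p, q) with Y = (α, β; p, q) ∈ SL₂(ℤ) (Bézout);
-- then X = (m p + k q, K; MN, u) has determinant 1 and XY has bottom row
-- MN (α, β) + u (p, q) ≡ (b₁, b₂). Finally any e with the same bottom row as
-- h ∈ SL₂(ℤ) equals (det e, t; 0, 1) h, so if det e ≡ 1 (mod N) then
-- (1, t; 0, 1) h has the prescribed top row modulo N.
module Submission where

open import Defs
open import Data.Nat using (ℕ; _≤_; NonZero)
import Data.Nat as ℕ
import Data.Nat.Properties as ℕP
import Data.Nat.Divisibility as ℕD
open import Data.Nat.DivMod using (m<n⇒m%n≡m)
open import Data.Nat.GCD using (GCD; module GCD; mkGCD; GCD-*; module Bézout)
open import Data.Integer using (ℤ; +_; -_; _+_; _-_; _*_; _⊖_; ∣_∣; _%ℕ_; _/ℕ_)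
import Data.Integer.Properties as ℤP
open import Data.Integer.DivMod using (n%ℕd<d; a≡a%ℕn+[a/ℕn]*n)
open import Data.Integer.Divisibility.Signed
  using (_∣_; divides; ∣ᵤ⇒∣; ∣⇒∣ᵤ; ∣-trans; ∣m∣n⇒∣m+n; ∣m⇒∣-m; ∣n⇒∣m*n; ∣m⇒∣m*n)
open import Data.Integer.Tactic.RingSolver using (solve-∀)
open import Data.Fin using (Fin; toℕ)
import Data.Fin.Properties as FinP
open import Data.Product using (Σ; _×_; _,_; proj₁; proj₂)
open import Level using (0ℓ)
open import Relation.Binary.Bundles using (Setoid)
import Relation.Binary.Reasoning.Setoid as SetoidReasoning
open import Relation.Binary.PropositionalEquality

infix 4 _≈_[mod_]

-- x ≋ y [mod n ] unfolds to n ∣ ∣ x - y ∣, from which Agda cannot infer x and y;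
-- this record (over signed divisibility) keeps them visible.
record _≈_[mod_] (x y : ℤ) (n : ℕ) : Set where
  constructor mk≈
  field
    n∣x-y : + n ∣ x - y

≋⇒≈ : ∀ {x y n} → x ≋ y [mod n ] → x ≈ y [mod n ]
≋⇒≈ h = mk≈ (∣ᵤ⇒∣ h)

≈⇒≋ : ∀ {x y n} → x ≈ y [mod n ] → x ≋ y [mod n ]
≈⇒≋ (mk≈ h) = ∣⇒∣ᵤ h

module _ {n : ℕ} where

  ≈-reflexive : ∀ {x y} → x ≡ y → x ≈ y [mod n ]
  ≈-reflexive {x} refl = mk≈ (divides (+ 0) (ℤP.+-inverseʳ x))

  ≈-refl : ∀ {x} → x ≈ x [mod n ]
  ≈-refl = ≈-reflexive refl

  ≈-sym : ∀ {x y} → x ≈ y [mod n ] → y ≈ x [mod n ]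
  ≈-sym {x} {y} (mk≈ h) = mk≈ (subst (+ n ∣_) (negate x y) (∣m⇒∣-m h))
    where
    negate : ∀ x y → - (x - y) ≡ y - x
    negate = solve-∀

  ≈-trans : ∀ {x y z} → x ≈ y [mod n ] → y ≈ z [mod n ] → x ≈ z [mod n ]
  ≈-trans {x} {y} {z} (mk≈ h) (mk≈ h') =
    mk≈ (subst (+ n ∣_) (ℤP.+-minus-telescope x y z) (∣m∣n⇒∣m+n h h'))

  +-cong : ∀ {x x' y y'} → x ≈ x' [mod n ] → y ≈ y' [mod n ] → x + y ≈ x' + y' [mod n ]
  +-cong {x} {x'} {y} {y'} (mk≈ h) (mk≈ h') =
    mk≈ (subst (+ n ∣_) (regroup x x' y y') (∣m∣n⇒∣m+n h h'))
    where
    regroup : ∀ x x' y y' → (x - x') + (y - y') ≡ (x + y) - (x' + y')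
    regroup = solve-∀

  -‿cong : ∀ {x x'} → x ≈ x' [mod n ] → - x ≈ - x' [mod n ]
  -‿cong {x} {x'} (mk≈ h) = mk≈ (subst (+ n ∣_) (negate x x') (∣m⇒∣-m h))
    where
    negate : ∀ x x' → - (x - x') ≡ - x - - x'
    negate = solve-∀

  *-cong : ∀ {x x' y y'} → x ≈ x' [mod n ] → y ≈ y' [mod n ] → x * y ≈ x' * y' [mod n ]
  *-cong {x} {x'} {y} {y'} (mk≈ h) (mk≈ h') =
    mk≈ (subst (+ n ∣_) (regroup x x' y y') (∣m∣n⇒∣m+n (∣m⇒∣m*n y h) (∣n⇒∣m*n x' h')))
    where
    regroup : ∀ x x' y y' → (x - x') * y + x' * (y - y') ≡ x * y - x' * y'
    regroup = solve-∀

  *-congˡ : ∀ x {y y'} → y ≈ y' [mod n ] → x * y ≈ x * y' [mod n ]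
  *-congˡ x = *-cong {x = x} {x} ≈-refl

  n*k+x≈x : ∀ k x → + n * k + x ≈ x [mod n ]
  n*k+x≈x k x = mk≈ (divides k (cancel (+ n) k x))
    where
    cancel : ∀ n k x → (n * k + x) - x ≡ k * n
    cancel = solve-∀

  ≈-divisor : ∀ {d x y} → d ℕD.∣ n → x ≈ y [mod n ] → x ≈ y [mod d ]
  ≈-divisor d∣n (mk≈ h) = mk≈ (∣-trans (∣ᵤ⇒∣ d∣n) h)

≈-setoid : ℕ → Setoid 0ℓ 0ℓ
≈-setoid n = record
  { Carrier       = ℤ
  ; _≈_           = λ x y → x ≈ y [mod n ]
  ; isEquivalence = record { refl = ≈-refl ; sym = ≈-sym ; trans = ≈-trans }
  }

module ≈-Reasoning (n : ℕ) = SetoidReasoning (≈-setoid n)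

⟦⟧-injective : ∀ {n} .{{_ : NonZero n}} {i j : Fin n} → ⟦ i ⟧ ≈ ⟦ j ⟧ [mod n ] → i ≡ j
⟦⟧-injective {n} {i = i} {j} (mk≈ h) =
  FinP.toℕ-injective (ℤP.+-injective (ℤP.i-j≡0⇒i≡j _ _ (ℤP.∣i∣≡0⇒i≡0 distance≡0)))
  where
  distance = ∣ ⟦ i ⟧ - ⟦ j ⟧ ∣
  distance<n : distance ℕ.< n
  distance<n = begin-strict
    distance                  ≡⟨ cong ∣_∣ (ℤP.m-n≡m⊖n (toℕ i) (toℕ j)) ⟩
    ∣ toℕ i ⊖ toℕ j ∣          ≤⟨ ℤP.∣m⊝n∣≤m⊔n (toℕ i) (toℕ j) ⟩
    toℕ i ℕ.⊔ toℕ j            <⟨ ℕP.⊔-pres-<m (FinP.toℕ<n i) (FinP.toℕ<n j) ⟩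
    n                         ∎
    where open ℕP.≤-Reasoning
  distance≡0 : distance ≡ 0
  distance≡0 = trans (sym (m<n⇒m%n≡m distance<n)) (ℕD.n∣m⇒m%n≡0 distance n (∣⇒∣ᵤ h))

cong₄ : ∀ {A B C D E : Set} (f : A → B → C → D → E) {a a' b b' c c' d d'} →
        a ≡ a' → b ≡ b' → c ≡ c' → d ≡ d' → f a b c d ≡ f a' b' c' d'
cong₄ f refl refl refl refl = refl

I : Mat
I = mat (+ 1) (+ 0) (+ 0) (+ 1)

adj : Mat → Mat
adj (mat a b c d) = mat d (- b) (- c) a

det-· : ∀ g h → det (g · h) ≡ det g * det h
det-· (mat a b c d) (mat e f g h) = multiplicative a b c d e f g h
  where
  multiplicative : ∀ a b c d e f g h →
    (a * e + b * g) * (c * f + d * h) - (a * f + b * h) * (c * e + d * g)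
    ≡ (a * d - b * c) * (e * h - f * g)
  multiplicative = solve-∀

det-adj : ∀ g → det (adj g) ≡ det g
det-adj (mat a b c d) = swap a b c d
  where
  swap : ∀ a b c d → d * a - (- b) * (- c) ≡ a * d - b * c
  swap = solve-∀

·-assoc : ∀ g h k → (g · h) · k ≡ g · (h · k)
·-assoc (mat a b c d) (mat e f g h) (mat i j k l) =
  cong₄ mat (entry a b e f g h i k) (entry a b e f g h j l)
        (entry c d e f g h i k) (entry c d e f g h j l)
  where
  entry : ∀ x y e f g h z w → (x * e + y * g) * z + (x * f + y * h) * w
                              ≡ x * (e * z + f * w) + y * (g * z + h * w)
  entry = solve-∀

·-identityˡ : ∀ g → I · g ≡ g
·-identityˡ (mat a b c d) = cong₄ mat (entry a c) (entry b d) (entry' a c) (entry' b d)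
  where
  entry : ∀ x y → + 1 * x + + 0 * y ≡ x
  entry = solve-∀
  entry' : ∀ x y → + 0 * x + + 1 * y ≡ y
  entry' = solve-∀

·-identityʳ : ∀ g → g · I ≡ g
·-identityʳ (mat a b c d) = cong₄ mat (entry a b) (entry' a b) (entry c d) (entry' c d)
  where
  entry : ∀ x y → x * + 1 + y * + 0 ≡ x
  entry = solve-∀
  entry' : ∀ x y → x * + 0 + y * + 1 ≡ y
  entry' = solve-∀

adj-inverseˡ : ∀ g → det g ≡ + 1 → adj g · g ≡ I
adj-inverseˡ (mat a b c d) det≡1 =
  cong₄ mat (trans (diagonal a b c d) det≡1) (off-diagonal b d)
        (off-diagonal' c a) (trans (diagonal' a b c d) det≡1)
  where
  diagonal : ∀ a b c d → d * a + (- b) * c ≡ a * d - b * c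
  diagonal = solve-∀
  diagonal' : ∀ a b c d → (- c) * b + a * d ≡ a * d - b * c
  diagonal' = solve-∀
  off-diagonal : ∀ x y → y * x + (- x) * y ≡ + 0
  off-diagonal = solve-∀
  off-diagonal' : ∀ x y → (- x) * y + y * x ≡ + 0
  off-diagonal' = solve-∀

adj-inverseʳ : ∀ g → det g ≡ + 1 → g · adj g ≡ I
adj-inverseʳ (mat a b c d) det≡1 =
  cong₄ mat (trans (diagonal a b c d) det≡1) (off-diagonal a b)
        (off-diagonal' c d) (trans (diagonal' a b c d) det≡1)
  where
  diagonal : ∀ a b c d → a * d + b * (- c) ≡ a * d - b * c
  diagonal = solve-∀
  diagonal' : ∀ a b c d → c * (- b) + d * a ≡ a * d - b * c
  diagonal' = solve-∀
  off-diagonal : ∀ x y → x * (- y) + y * x ≡ + 0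
  off-diagonal = solve-∀
  off-diagonal' : ∀ x y → x * y + y * (- x) ≡ + 0
  off-diagonal' = solve-∀

·-adj-cancelʳ : ∀ e g → det g ≡ + 1 → (e · adj g) · g ≡ e
·-adj-cancelʳ e g det≡1 = begin
  (e · adj g) · g   ≡⟨ ·-assoc e (adj g) g ⟩
  e · (adj g · g)   ≡⟨ cong (e ·_) (adj-inverseˡ g det≡1) ⟩
  e · I             ≡⟨ ·-identityʳ e ⟩
  e                 ∎
  where open ≡-Reasoning

bottom-row-factorisation : ∀ {A B C D} x y → det (mat A B C D) ≡ + 1 →
  mat (x * D - y * C) (y * A - x * B) (+ 0) (+ 1) · mat A B C D ≡ mat x y C D
bottom-row-factorisation {A} {B} {C} {D} x y det≡1 =
  cong₄ mat (scale x (top-left x y A B C D)) (scale y (top-right x y A B C D))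
        (cong Mat.c (·-identityˡ (mat A B C D))) (cong Mat.d (·-identityˡ (mat A B C D)))
  where
  scale : ∀ z {w} → w ≡ z * (A * D - B * C) → w ≡ z
  scale z w≡ = trans w≡ (trans (cong (z *_) det≡1) (ℤP.*-identityʳ z))
  top-left : ∀ x y A B C D →
    (x * D - y * C) * A + (y * A - x * B) * C ≡ x * (A * D - B * C)
  top-left = solve-∀
  top-right : ∀ x y A B C D →
    (x * D - y * C) * B + (y * A - x * B) * D ≡ y * (A * D - B * C)
  top-right = solve-∀

infixl 7 _∙_
infix 8 _⁻¹

_∙_ : SL2Z → SL2Z → SL2Z
(g , det-g) ∙ (h , det-h) = g · h , trans (det-· g h) (cong₂ _*_ det-g det-h)

_⁻¹ : SL2Z → SL2Z
(g , det-g) ⁻¹ = adj g , trans (det-adj g) det-g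

shear : ℤ → SL2Z
shear t = mat (+ 1) t (+ 0) (+ 1) , cong (λ z → + 1 - z) (ℤP.*-zeroʳ t)

infix 4 _≈_[rows-mod_,_]

record _≈_[rows-mod_,_] (g h : Mat) (n₁ n₂ : ℕ) : Set where
  constructor rows
  field
    ≈₁₁ : Mat.a g ≈ Mat.a h [mod n₁ ]
    ≈₁₂ : Mat.b g ≈ Mat.b h [mod n₁ ]
    ≈₂₁ : Mat.c g ≈ Mat.c h [mod n₂ ]
    ≈₂₂ : Mat.d g ≈ Mat.d h [mod n₂ ]

module _ {n₁ n₂ : ℕ} where

  rows-reflexive : ∀ {g h} → g ≡ h → g ≈ h [rows-mod n₁ , n₂ ]
  rows-reflexive refl = rows ≈-refl ≈-refl ≈-refl ≈-refl

  rows-sym : ∀ {g h} → g ≈ h [rows-mod n₁ , n₂ ] → h ≈ g [rows-mod n₁ , n₂ ]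
  rows-sym (rows p q r s) = rows (≈-sym p) (≈-sym q) (≈-sym r) (≈-sym s)

  rows-trans : ∀ {g h k} → g ≈ h [rows-mod n₁ , n₂ ] → h ≈ k [rows-mod n₁ , n₂ ] →
               g ≈ k [rows-mod n₁ , n₂ ]
  rows-trans (rows p q r s) (rows p' q' r' s') =
    rows (≈-trans p p') (≈-trans q q') (≈-trans r r') (≈-trans s s')

  ·-congʳ : ∀ {g g'} h → g ≈ g' [rows-mod n₁ , n₂ ] → g · h ≈ g' · h [rows-mod n₁ , n₂ ]
  ·-congʳ (mat e f g h) (rows p q r s) =
    rows (combine p q) (combine p q) (combine r s) (combine r s)
    where
    combine : ∀ {n x x' y y' z w} → x ≈ x' [mod n ] → y ≈ y' [mod n ] →
              x * z + y * w ≈ x' * z + y' * w [mod n ]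
    combine p q = +-cong (*-cong p ≈-refl) (*-cong q ≈-refl)

  det-cong : ∀ {g h} → n₁ ℕD.∣ n₂ → g ≈ h [rows-mod n₁ , n₂ ] → det g ≈ det h [mod n₁ ]
  det-cong n₁∣n₂ (rows p q r s) =
    +-cong (*-cong p (≈-divisor n₁∣n₂ s)) (-‿cong (*-cong q (≈-divisor n₁∣n₂ r)))

columns-generate : ∀ {n₁ n₂ g} (h : SL2Z) → g ≈ proj₁ h [rows-mod n₁ , n₂ ] → ∀ x y →
  Σ ℤ λ m → Σ ℤ λ k → (m * Mat.a g + k * Mat.b g ≈ x [mod n₁ ])
                    × (m * Mat.c g + k * Mat.d g ≈ y [mod n₂ ])
columns-generate {n₁} {n₂} (mat a b c d , det≡1) (rows p q r s) x y =
  m , k , solves n₁ p q (cramer₁ a b c d x y) , solves n₂ r s (cramer₂ a b c d x y)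
  where
  m = d * x - b * y
  k = a * y - c * x
  solves : ∀ n {u u' v v' z} → u ≈ u' [mod n ] → v ≈ v' [mod n ] →
           m * u' + k * v' ≡ z * (a * d - b * c) → m * u + k * v ≈ z [mod n ]
  solves n {u} {u'} {v} {v'} {z} u≈ v≈ eq = begin
    m * u + k * v          ≈⟨ +-cong (*-congˡ m u≈) (*-congˡ k v≈) ⟩
    m * u' + k * v'        ≡⟨ eq ⟩
    z * (a * d - b * c)    ≡⟨ cong (z *_) det≡1 ⟩
    z * + 1                ≡⟨ ℤP.*-identityʳ z ⟩
    z                      ∎
    where open ≈-Reasoning n
  cramer₁ : ∀ a b c d x y → (d * x - b * y) * a + (a * y - c * x) * b ≡ x * (a * d - b * c)
  cramer₁ = solve-∀
  cramer₂ : ∀ a b c d x y → (d * x - b * y) * c + (a * y - c * x) * d ≡ y * (a * d - b * c)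
  cramer₂ = solve-∀

complete-top-row : ∀ {n₁ n₂ A B C D} → det (mat A B C D) ≡ + 1 → ∀ x y →
  x * D - y * C ≈ + 1 [mod n₁ ] → Σ SL2Z λ g → proj₁ g ≈ mat x y C D [rows-mod n₁ , n₂ ]
complete-top-row {n₁} {n₂} {A} {B} {C} {D} det≡1 x y det≈1 =
  shear T ∙ (mat A B C D , det≡1) ,
  rows-trans (·-congʳ (mat A B C D) shear≈) (rows-reflexive (bottom-row-factorisation x y det≡1))
  where
  T = y * A - x * B
  shear≈ : proj₁ (shear T) ≈ mat (x * D - y * C) T (+ 0) (+ 1) [rows-mod n₁ , n₂ ]
  shear≈ = rows (≈-sym det≈1) ≈-refl ≈-refl ≈-refl

primitive-multiple : ∀ b₁ b₂ → Σ ℕ λ u → Σ ℕ λ p → Σ ℕ λ q →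
  Bézout.Identity 1 p q × b₁ ≡ u ℕ.* p × b₂ ≡ u ℕ.* q
primitive-multiple b₁ b₂ with mkGCD b₁ b₂
... | ℕ.zero , g = 0 , 0 , 1 , Bézout.-+ 0 1 refl , ℕD.0∣⇒≡0 (GCD.gcd∣m g) , ℕD.0∣⇒≡0 (GCD.gcd∣n g)
... | u@(ℕ.suc _) , g with GCD.gcd∣m g | GCD.gcd∣n g
...   | ℕD.divides p refl | ℕD.divides q refl =
  u , p , q , Bézout.identity (GCD-* (subst (GCD (p ℕ.* u) (q ℕ.* u)) (sym (ℕP.*-identityˡ u)) g)) ,
  ℕP.*-comm p u , ℕP.*-comm q u

1+v≡u⇒u-v≡1 : ∀ u v → + 1 + v ≡ u → u - v ≡ + 1
1+v≡u⇒u-v≡1 _ v refl = cancel v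
  where
  cancel : ∀ v → (+ 1 + v) - v ≡ + 1
  cancel = solve-∀

toℤ-Identity : ∀ d x y m n → d ℕ.+ y ℕ.* n ≡ x ℕ.* m → + d + + y * + n ≡ + x * + m
toℤ-Identity d x y m n eq = begin
  + d + + y * + n       ≡⟨ cong (λ z → + d + z) (ℤP.pos-* y n) ⟨
  + d + + (y ℕ.* n)     ≡⟨ ℤP.pos-+ d (y ℕ.* n) ⟨
  + (d ℕ.+ y ℕ.* n)     ≡⟨ cong +_ eq ⟩
  + (x ℕ.* m)           ≡⟨ ℤP.pos-* x m ⟩
  + x * + m             ∎
  where open ≡-Reasoning

complete-primitive-row : ∀ {p q} → Bézout.Identity 1 p q →
  Σ ℤ λ α → Σ ℤ λ β → det (mat α β (+ p) (+ q)) ≡ + 1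
complete-primitive-row {p} {q} (Bézout.+- x y eq) =
  - + y , - + x ,
  trans (swap (+ x) (+ y) (+ p) (+ q)) (1+v≡u⇒u-v≡1 _ _ (toℤ-Identity 1 x y p q eq))
  where
  swap : ∀ x y p q → (- y) * q - (- x) * p ≡ x * p - y * q
  swap = solve-∀
complete-primitive-row {p} {q} (Bézout.-+ x y eq) =
  + y , + x , 1+v≡u⇒u-v≡1 _ _ (toℤ-Identity 1 y x q p eq)

lift-bottom-row : ∀ {n} b₁ b₂ m k → m * + b₁ + k * + b₂ ≈ + 1 [mod n ] →
  Σ SL2Z λ h → (Mat.c (proj₁ h) ≈ + b₁ [mod n ]) × (Mat.d (proj₁ h) ≈ + b₂ [mod n ])
lift-bottom-row {n} b₁ b₂ m k (mk≈ (divides K eq)) with primitive-multiple b₁ b₂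
... | u , p , q , bz , refl , refl with complete-primitive-row bz
...   | α , β , det-Y = X ∙ Y , bottom α p , bottom β q
  where
  Y : SL2Z
  Y = mat α β (+ p) (+ q) , det-Y
  eq' : m * (+ u * + p) + k * (+ u * + q) - + 1 ≡ K * + n
  eq' = subst₂ (λ s t → m * s + k * t - + 1 ≡ K * + n) (ℤP.pos-* u p) (ℤP.pos-* u q) eq
  det-X : (m * + p + k * + q) * + u - K * + n ≡ + 1
  det-X = begin
    (m * + p + k * + q) * + u - K * + n
      ≡⟨ regroup m k (+ p) (+ q) (+ u) (K * + n) ⟩
    (m * (+ u * + p) + k * (+ u * + q) - + 1) - K * + n + + 1
      ≡⟨ cong (λ t → t - K * + n + + 1) eq' ⟩
    K * + n - K * + n + + 1
      ≡⟨ cancel (K * + n) ⟩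
    + 1 ∎
    where
    open ≡-Reasoning
    regroup : ∀ m k p q u z → (m * p + k * q) * u - z ≡ (m * (u * p) + k * (u * q) - + 1) - z + + 1
    regroup = solve-∀
    cancel : ∀ z → z - z + + 1 ≡ + 1
    cancel = solve-∀
  X : SL2Z
  X = mat (m * + p + k * + q) K (+ n) (+ u) , det-X
  bottom : ∀ γ r → + n * γ + + u * + r ≈ + (u ℕ.* r) [mod n ]
  bottom γ r = ≈-trans (n*k+x≈x γ (+ u * + r)) (≈-reflexive (sym (ℤP.pos-* u r)))

lift-to-SL2 : ∀ {n₁ n₂} x y b₁ b₂ m k → n₁ ℕD.∣ n₂ →
  x * + b₂ - y * + b₁ ≈ + 1 [mod n₁ ] → m * + b₁ + k * + b₂ ≈ + 1 [mod n₂ ] →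
  Σ SL2Z λ g → proj₁ g ≈ mat x y (+ b₁) (+ b₂) [rows-mod n₁ , n₂ ]
lift-to-SL2 {n₁} {n₂} x y b₁ b₂ m k n₁∣n₂ det≈1 unimodular
  with lift-bottom-row b₁ b₂ m k unimodular
... | (mat A B C D , det-h) , C≈b₁ , D≈b₂ =
  let g , g≈e = complete-top-row {A = A} {B} det-h x y (≈-trans (det-cong n₁∣n₂ e≈) det≈1)
  in g , rows-trans g≈e e≈
  where
  e≈ : mat x y C D ≈ mat x y (+ b₁) (+ b₂) [rows-mod n₁ , n₂ ]
  e≈ = rows ≈-refl ≈-refl C≈b₁ D≈b₂

module _ (N M : ℕ) .{{_ : NonZero N}} .{{_ : NonZero M}} where

  instance
    MN≢0 : NonZero (MN N M)
    MN≢0 = nzMN N M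

  ⟦red⟧≈ : ∀ n .{{_ : NonZero n}} x → ⟦ red N M n x ⟧ ≈ x [mod n ]
  ⟦red⟧≈ n x = ≈-trans (≈-reflexive (cong +_ (FinP.toℕ-fromℕ< (n%ℕd<d x n)))) remainder≈x
    where
    r = x %ℕ n
    q = x /ℕ n
    remainder≈x : + r ≈ x [mod n ]
    remainder≈x = mk≈ (divides (- q) (begin
      + r - x                 ≡⟨ cong (λ z → + r - z) (a≡a%ℕn+[a/ℕn]*n x n) ⟩
      + r - (+ r + q * + n)   ≡⟨ cancel (+ r) q (+ n) ⟩
      - q * + n               ∎))
      where
      open ≡-Reasoning
      cancel : ∀ r q n → r - (r + q * n) ≡ - q * n
      cancel = solve-∀

  red-≈⟦⟧ : ∀ n .{{_ : NonZero n}} {x} {i : Fin n} → x ≈ ⟦ i ⟧ [mod n ] → red N M n x ≡ i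
  red-≈⟦⟧ n {x} x≈i = ⟦⟧-injective (≈-trans (⟦red⟧≈ n x) x≈i)

  lift : Entries N M → Mat
  lift (entries a₁ a₂ b₁ b₂) = mat ⟦ a₁ ⟧ ⟦ a₂ ⟧ ⟦ b₁ ⟧ ⟦ b₂ ⟧

  lift-φ : ∀ g → lift (φ N M g) ≈ proj₁ g [rows-mod N , MN N M ]
  lift-φ (mat a b c d , _) =
    rows (⟦red⟧≈ N a) (⟦red⟧≈ N b) (⟦red⟧≈ (MN N M) c) (⟦red⟧≈ (MN N M) d)

  ≈-lift⇒φ≡ : ∀ g s → proj₁ g ≈ lift s [rows-mod N , MN N M ] → φ N M g ≡ s
  ≈-lift⇒φ≡ _ _ (rows p q r s) =
    cong₄ entries (red-≈⟦⟧ N p) (red-≈⟦⟧ N q) (red-≈⟦⟧ (MN N M) r) (red-≈⟦⟧ (MN N M) s)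

  φ-cong : ∀ g h → proj₁ g ≈ proj₁ h [rows-mod N , MN N M ] → φ N M g ≡ φ N M h
  φ-cong g h g≈h = ≈-lift⇒φ≡ g (φ N M h) (rows-trans g≈h (rows-sym (lift-φ h)))

  φ-injective : ∀ g h → φ N M g ≡ φ N M h → proj₁ g ≈ proj₁ h [rows-mod N , MN N M ]
  φ-injective g h φg≡φh =
    rows-trans (rows-sym (lift-φ g))
               (subst (λ s → lift s ≈ proj₁ h [rows-mod N , MN N M ]) (sym φg≡φh) (lift-φ h))

  InΓ⇒≈I : ∀ γ → InΓ N M γ → proj₁ γ ≈ I [rows-mod N , MN N M ]
  InΓ⇒≈I _ (a≋1 , b≋0 , c≋0 , d≋1) = rows (≋⇒≈ a≋1) (≋⇒≈ b≋0) (≋⇒≈ c≋0) (≋⇒≈ d≋1)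

  ≈I⇒InΓ : ∀ γ → proj₁ γ ≈ I [rows-mod N , MN N M ] → InΓ N M γ
  ≈I⇒InΓ _ (rows p q r s) = ≈⇒≋ p , ≈⇒≋ q , ≈⇒≋ r , ≈⇒≋ s

  φ-lands-in-S : ∀ g → InS N M (φ N M g)
  φ-lands-in-S g =
    (λ x y → to≋ (columns-generate g (lift-φ g) ⟦ x ⟧ ⟦ y ⟧)) ,
    ≈⇒≋ (≈-trans (det-cong (ℕD.n∣m*n M) (lift-φ g)) (≈-reflexive (proj₂ g)))
    where
    to≋ : ∀ {n₁ n₂ : ℕ} {a b c d x y : ℤ} →
      (Σ ℤ λ m → Σ ℤ λ k → (m * a + k * b ≈ x [mod n₁ ]) × (m * c + k * d ≈ y [mod n₂ ])) →
      Σ ℤ λ m → Σ ℤ λ k → ((m * a + k * b) ≋ x [mod n₁ ]) × ((m * c + k * d) ≋ y [mod n₂ ])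
    to≋ (m , k , p , q) = m , k , ≈⇒≋ p , ≈⇒≋ q

  φ-constant-on-cosets : ∀ g g' → SameCoset N M g g' → φ N M g ≡ φ N M g'
  φ-constant-on-cosets g (_ , _) (γ , γ∈Γ , refl) =
    sym (φ-cong (γ ∙ g) g (rows-trans (·-congʳ (proj₁ g) (InΓ⇒≈I γ γ∈Γ))
                                      (rows-reflexive (·-identityˡ (proj₁ g)))))

  φ-injective-on-cosets : ∀ g g' → φ N M g ≡ φ N M g' → SameCoset N M g g'
  φ-injective-on-cosets g g' φg≡φg' =
    g' ∙ g ⁻¹ ,
    ≈I⇒InΓ (g' ∙ g ⁻¹) (rows-trans (·-congʳ (adj (proj₁ g)) (φ-injective g' g (sym φg≡φg')))
                                   (rows-reflexive (adj-inverseʳ (proj₁ g) (proj₂ g)))) ,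
    ·-adj-cancelʳ (proj₁ g') (proj₁ g) (proj₂ g)

  φ-surjective : ∀ s → InS N M s → Σ SL2Z (λ g → φ N M g ≡ s)
  φ-surjective s@(entries a₁ a₂ b₁ b₂) (generates , det≋1)
    with generates (red N M N (+ 0)) (red N M (MN N M) (+ 1))
  ... | m , k , _ , unimodular =
    let g , g≈s = lift-to-SL2 ⟦ a₁ ⟧ ⟦ a₂ ⟧ (toℕ b₁) (toℕ b₂) m k (ℕD.n∣m*n M) (≋⇒≈ det≋1)
                    (≈-trans (≋⇒≈ unimodular) (⟦red⟧≈ (MN N M) (+ 1)))
    in g , ≈-lift⇒φ≡ g s g≈s

proposition3p4 : (N M : ℕ) → 2 ≤ N → 1 ≤ M → .{{_ : NonZero N}} → .{{_ : NonZero M}} → IsWellDefinedBijection N M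
proposition3p4 N M _ _ =
  φ-lands-in-S N M , φ-constant-on-cosets N M , φ-injective-on-cosets N M , φ-surjective N M
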